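{- Let $L_1, L_2$ be disjoint finite lattices with $\operatorname{Dim}(L_1)=m$ and $\operatorname{Dim}(L_2)=n$, let $a<b$ in $L_1$ with $b$ not covering $a$, and let $L = L_1 ]^{b}_{a} L_2$. If $m \geq n$ then $m \leq \operatorname{Dim}(L) \leq m+1$, and if $m < n$ then $\operatorname{Dim}(L) = n$.
   Context: Adjunct sum: for disjoint lattices $L_1,L_2$ and $a<b$ in $L_1$ with $a \not\prec b$, $L = L_1 ]^b_a L_2$ is the set $L_1 \cup L_2$ with $x \leq y$ iff either $x,y\in L_1$ and $x\leq y$ in $L_1$; or $x,y\in L_2$ and $x\leq y$ in $L_2$; or $x\in L_1$, $y\in L_2$ and $x \leq a$ in $L_1$; or $x \in L_2$, $y \in L_1$ and $b \leq y$ in $L_1$. The dimension $\operatorname{Dim}(P)$ of a finite poset $P$ is the least number of linear extensions of its order whose intersection is exactly its order. -}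

module Defs where

open import Level using (0ℓ)
open import Data.Nat using (ℕ; _≤_)
open import Data.Fin using (Fin)
open import Data.Sum using (_⊎_; inj₁; inj₂)
open import Data.Product using (_×_; ∃-syntax)
open import Data.Empty using (⊥)
open import Relation.Nullary using (¬_)
open import Relation.Binary using (Rel; IsPartialOrder; IsTotalOrder)
open import Relation.Binary.PropositionalEquality using (_≡_)
open import Relation.Binary.Lattice.Structures using (IsLattice)

record FinLattice (k : ℕ) : Set₁ where
  field
    _≤L_ : Rel (Fin k) 0ℓ
    _∨_  : Fin k → Fin k → Fin k
    _∧_  : Fin k → Fin k → Fin k
    isLattice : IsLattice _≡_ _≤L_ _∨_ _∧_

_<[_]_ : {A : Set} → A → Rel A 0ℓ → A → Set
x <[ R ] y = R x y × ¬ (x ≡ y)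

Covers : {A : Set} → Rel A 0ℓ → A → A → Set
Covers R a b = (a <[ R ] b) × ¬ (∃[ c ] ((a <[ R ] c) × (c <[ R ] b)))

record Realizer {A : Set} (_≼_ : Rel A 0ℓ) (d : ℕ) : Set₁ where
  field
    ext       : Fin d → Rel A 0ℓ
    linear    : ∀ i → IsTotalOrder _≡_ (ext i)
    extends   : ∀ i x y → x ≼ y → ext i x y
    intersect : ∀ x y → (∀ i → ext i x y) → x ≼ y

-- Dim(P) = d : d is the least number (≥ 1, the usual convention) of linear
-- extensions whose intersection is the order.
IsDim : {A : Set} → Rel A 0ℓ → ℕ → Set₁
IsDim _≼_ d = (1 ≤ d) × Realizer _≼_ d × (∀ d' → 1 ≤ d' → Realizer _≼_ d' → d ≤ d')

adjunct : ∀ {k₁ k₂} → FinLattice k₁ → FinLattice k₂ → Fin k₁ → Fin k₁ →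
          Rel (Fin k₁ ⊎ Fin k₂) 0ℓ
adjunct L₁ L₂ a b (inj₁ x) (inj₁ y) = FinLattice._≤L_ L₁ x y
adjunct L₁ L₂ a b (inj₂ x) (inj₂ y) = FinLattice._≤L_ L₂ x y
adjunct L₁ L₂ a b (inj₁ x) (inj₂ y) = FinLattice._≤L_ L₁ x a
adjunct L₁ L₂ a b (inj₂ x) (inj₁ y) = FinLattice._≤L_ L₁ b y

{-# OPTIONS --safe #-}
module Submission where

-- A realizer of L restricts to realizers of its suborders L₁ and L₂, so Dim L ≥ max(m, n).
-- Conversely, from realizers E₀ … E_p of L₁ and F₀ … F_{p+1} of L₂ (padded by repetition,
-- with p + 1 = max(m, n − 1)) build p + 2 linear extensions of L: extension j + 1 inserts
-- L₂, ordered by F_{j+1}, into E_j immediately below b; extension 0 lists the elements ≤ a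
-- in E₀-order, then L₂ by F₀, then the rest of L₁. The former recover every E_j on L₁ and
-- force b ≤ y whenever L₂ precedes y; the latter forces x ≤ a whenever x precedes L₂.
-- Hence Dim L ≤ max(m + 1, n). When n ≤ m, whether Dim L is m or m + 1 is decided by an
-- exhaustive search over m-tuples of Boolean relation tables on the finite carrier.

open import Defs
open import Level using (0ℓ)
open import Data.Bool using (T)
open import Data.Empty using (⊥-elim)
open import Data.Fin using (Fin; zero; suc)
open import Data.Fin.Properties using (all?; _≟_; +↔⊎)
open import Data.Fin.Subset using (Subset)
open import Data.Fin.Subset.Properties using (anySubset?)
open import Data.Nat using (ℕ; zero; suc; _≤_; _<_; _+_; z≤n; s≤s; _≤′_; ≤′-refl; ≤′-step)
open import Data.Nat.Properties using (≤-refl; ≤-reflexive; ≤-pred; +-comm; m≤m+n; n≤1+n; m≤n⇒m≤1+n; ≤∧≢⇒<; ≤⇒≤′)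
open import Data.Product using (_×_; _,_; ∃; ∃-syntax; proj₁; proj₂)
open import Data.Sum as Sum using (_⊎_; inj₁; inj₂)
open import Data.Sum.Properties using (inj₁-injective; inj₂-injective)
open import Data.Sum.Relation.Binary.LeftOrder using (_⊎-<_; ₁∼₂; ₁∼₁; ₂∼₂; ⊎-<-isTotalOrder)
open import Data.Sum.Relation.Binary.Pointwise as Pointwise using (Pointwise; Pointwise-≡⇒≡)
open import Data.Vec using (Vec; []; _∷_; lookup; tabulate)
open import Data.Vec.Properties using (lookup∘tabulate)
open import Function using (id; _∘_; _↔_; Inverse; Injection)
open import Function.Properties.Inverse using (↔-sym; Inverse⇒Injection)
open import Relation.Binary using (Rel; Decidable; DecidableEquality; IsTotalOrder)
open import Relation.Binary.Consequences using (total∧dec⇒dec)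
open import Relation.Binary.Lattice.Bundles using (Lattice)
open import Relation.Binary.Lattice.Structures using (IsLattice)
import Relation.Binary.Lattice.Properties.JoinSemilattice as JoinSemilattice
open import Relation.Binary.PropositionalEquality
open import Relation.Nullary using (¬_; Dec; yes; no; ¬?)
open import Relation.Nullary.Decidable using (map′; _×-dec_; _→-dec_; _⊎-dec_; T?; isYes; toWitness; fromWitness)
open import Relation.Unary as U using (Pred)

module _ {A B : Set} {_≈_ _⊑_ : Rel B 0ℓ} {_≼_ : Rel A 0ℓ} (f : A → B)
         (f-injective : ∀ {x y} → f x ≈ f y → x ≡ y)
         (f-mono : ∀ {x y} → x ≼ y → f x ⊑ f y) (f-reflects : ∀ {x y} → f x ⊑ f y → x ≼ y) where

  isTotalOrder-pullback : IsTotalOrder _≈_ _⊑_ → IsTotalOrder _≡_ _≼_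
  isTotalOrder-pullback tot = record
    { isPartialOrder = record
      { isPreorder = record
        { isEquivalence = isEquivalence
        ; reflexive = λ { refl → f-reflects ⊑.refl }
        ; trans = λ x≼y y≼z → f-reflects (⊑.trans (f-mono x≼y) (f-mono y≼z)) }
      ; antisym = λ x≼y y≼x → f-injective (⊑.antisym (f-mono x≼y) (f-mono y≼x)) }
    ; total = λ x y → Sum.map f-reflects f-reflects (⊑.total (f x) (f y)) }
    where module ⊑ = IsTotalOrder tot

module _ {A B : Set} {_⊑_ : Rel B 0ℓ} {_≼_ : Rel A 0ℓ} (f : A → B)
         (f-injective : ∀ {x y} → f x ≡ f y → x ≡ y)
         (f-mono : ∀ {x y} → x ≼ y → f x ⊑ f y) (f-reflects : ∀ {x y} → f x ⊑ f y → x ≼ y) where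

  realizer-pullback : ∀ {d} → Realizer _⊑_ d → Realizer _≼_ d
  realizer-pullback r = record
    { ext = λ i x y → ext i (f x) (f y)
    ; linear = λ i → isTotalOrder-pullback f f-injective id id (linear i)
    ; extends = λ i x y x≼y → extends i (f x) (f y) (f-mono x≼y)
    ; intersect = λ x y h → f-reflects (intersect (f x) (f y) h) }
    where open Realizer r

module _ {A : Set} {R : Rel A 0ℓ} where

  realizer-duplicate : ∀ {d} → Realizer R (suc d) → Realizer R (suc (suc d))
  realizer-duplicate r = record
    { ext = λ { zero → ext zero ; (suc i) → ext i }
    ; linear = λ { zero → linear zero ; (suc i) → linear i }
    ; extends = λ { zero → extends zero ; (suc i) → extends i }
    ; intersect = λ x y h → intersect x y (λ i → h (suc i)) }
    where open Realizer r

  realizer-weaken : ∀ {m d} → m ≤ d → Realizer R (suc m) → Realizer R (suc d)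
  realizer-weaken m≤d = go (≤⇒≤′ m≤d)
    where
    go : ∀ {m d} → m ≤′ d → Realizer R (suc m) → Realizer R (suc d)
    go ≤′-refl r = r
    go (≤′-step m≤′d) r = realizer-duplicate (go m≤′d r)

module _ {A : Set} {E : Rel A 0ℓ} (_≟ᴬ_ : DecidableEquality A) (tot : IsTotalOrder _≡_ E) where
  private module E = IsTotalOrder tot

  isTotalOrder⇒decidable : Decidable E
  isTotalOrder⇒decidable = total∧dec⇒dec E.reflexive E.antisym E.total _≟ᴬ_

  <[]? : ∀ b → U.Decidable (λ x → x <[ E ] b)
  <[]? b x = isTotalOrder⇒decidable x b ×-dec ¬? (x ≟ᴬ b)

  ≮[]⇒≥ : ∀ {x b} → ¬ (x <[ E ] b) → E b x
  ≮[]⇒≥ {x} {b} x≮b with E.total x b | x ≟ᴬ b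
  ... | inj₂ b≤x | _        = b≤x
  ... | inj₁ _   | yes refl = E.refl
  ... | inj₁ x≤b | no x≢b   = ⊥-elim (x≮b (x≤b , x≢b))

  <[]-downClosed : ∀ {x y b} → E y x → x <[ E ] b → y <[ E ] b
  <[]-downClosed y≤x (x≤b , x≢b) = E.trans y≤x x≤b , λ { refl → x≢b (E.antisym x≤b y≤x) }

module Insertion {A B : Set} (E : Rel A 0ℓ) (F : Rel B 0ℓ) {D : Pred A 0ℓ} (D? : U.Decidable D) where

  place : A ⊎ B → A ⊎ (B ⊎ A)
  place (inj₁ x) with D? x
  ... | yes _ = inj₁ x
  ... | no _  = inj₂ (inj₂ x)
  place (inj₂ y) = inj₂ (inj₁ y)

  unplace : A ⊎ (B ⊎ A) → A ⊎ B
  unplace (inj₁ x)        = inj₁ x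
  unplace (inj₂ (inj₁ y)) = inj₂ y
  unplace (inj₂ (inj₂ x)) = inj₁ x

  unplace∘place : ∀ u → unplace (place u) ≡ u
  unplace∘place (inj₁ x) with D? x
  ... | yes _ = refl
  ... | no _  = refl
  unplace∘place (inj₂ y) = refl

  place-injective : ∀ {u v} → Pointwise _≡_ (Pointwise _≡_ _≡_) (place u) (place v) → u ≡ v
  place-injective {u} {v} p = begin
    u                   ≡⟨ unplace∘place u ⟨
    unplace (place u)   ≡⟨ cong unplace (pointwise⇒≡ p) ⟩
    unplace (place v)   ≡⟨ unplace∘place v ⟩
    v                   ∎
    where
    open ≡-Reasoning
    pointwise⇒≡ : ∀ {s t} → Pointwise _≡_ (Pointwise _≡_ _≡_) s t → s ≡ t
    pointwise⇒≡ (Pointwise.inj₁ s≡t) = cong inj₁ s≡t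
    pointwise⇒≡ (Pointwise.inj₂ s≈t) = cong inj₂ (Pointwise-≡⇒≡ s≈t)

  _⊑_ : Rel (A ⊎ B) 0ℓ
  u ⊑ v = (E ⊎-< (F ⊎-< E)) (place u) (place v)

  ⊑-isTotalOrder : IsTotalOrder _≡_ E → IsTotalOrder _≡_ F → IsTotalOrder _≡_ _⊑_
  ⊑-isTotalOrder totE totF =
    isTotalOrder-pullback place place-injective id id (⊎-<-isTotalOrder totE (⊎-<-isTotalOrder totF totE))

  inj₂⊑inj₂⁺ : ∀ {x y} → F x y → inj₂ x ⊑ inj₂ y
  inj₂⊑inj₂⁺ x≤y = ₂∼₂ (₁∼₁ x≤y)

  inj₂⊑inj₂⁻ : ∀ {x y} → inj₂ x ⊑ inj₂ y → F x y
  inj₂⊑inj₂⁻ (₂∼₂ (₁∼₁ x≤y)) = x≤y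

  inj₁⊑inj₂⁺ : ∀ {x y} → D x → inj₁ x ⊑ inj₂ y
  inj₁⊑inj₂⁺ {x} Dx with D? x
  ... | yes _  = ₁∼₂
  ... | no ¬Dx = ⊥-elim (¬Dx Dx)

  inj₁⊑inj₂⁻ : ∀ {x y} → inj₁ x ⊑ inj₂ y → D x
  inj₁⊑inj₂⁻ {x} x⊑y with D? x
  inj₁⊑inj₂⁻ x⊑y          | yes Dx = Dx
  inj₁⊑inj₂⁻ (₂∼₂ ())     | no _

  inj₂⊑inj₁⁺ : ∀ {x y} → ¬ D y → inj₂ x ⊑ inj₁ y
  inj₂⊑inj₁⁺ {y = y} ¬Dy with D? y
  ... | yes Dy = ⊥-elim (¬Dy Dy)
  ... | no _   = ₂∼₂ ₁∼₂

  inj₂⊑inj₁⁻ : ∀ {x y} → inj₂ x ⊑ inj₁ y → ¬ D y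
  inj₂⊑inj₁⁻ {y = y} x⊑y with D? y
  inj₂⊑inj₁⁻ ()        | yes _
  inj₂⊑inj₁⁻ x⊑y       | no ¬Dy = ¬Dy

  module _ {_≼_ : Rel A 0ℓ} (≼⇒E : ∀ {x y} → x ≼ y → E x y)
           (D-downClosed : ∀ {x y} → x ≼ y → D y → D x) where

    inj₁⊑inj₁⁺ : ∀ {x y} → x ≼ y → inj₁ x ⊑ inj₁ y
    inj₁⊑inj₁⁺ {x} {y} x≼y with D? x | D? y
    ... | yes _   | yes _ = ₁∼₁ (≼⇒E x≼y)
    ... | yes _   | no _  = ₁∼₂
    ... | no ¬Dx  | yes Dy = ⊥-elim (¬Dx (D-downClosed x≼y Dy))
    ... | no _    | no _  = ₂∼₂ (₂∼₂ (≼⇒E x≼y))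

  inj₁⊑inj₁⁻ : IsTotalOrder _≡_ E → (∀ {x y} → E x y → D y → D x) →
               ∀ {x y} → inj₁ x ⊑ inj₁ y → E x y
  inj₁⊑inj₁⁻ tot D-downClosed {x} {y} x⊑y with D? x | D? y
  inj₁⊑inj₁⁻ tot D-downClosed (₁∼₁ x≤y)       | yes _  | yes _ = x≤y
  inj₁⊑inj₁⁻ tot D-downClosed {x} {y} _        | yes Dx | no ¬Dy with IsTotalOrder.total tot x y
  ... | inj₁ x≤y = x≤y
  ... | inj₂ y≤x = ⊥-elim (¬Dy (D-downClosed y≤x Dx))
  inj₁⊑inj₁⁻ tot D-downClosed ()               | no _   | yes _
  inj₁⊑inj₁⁻ tot D-downClosed (₂∼₂ (₂∼₂ x≤y)) | no _   | no _ = x≤y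

Searchable : Set → Set₁
Searchable A = ∀ {P : Pred A 0ℓ} → U.Decidable P → Dec (∃ P)

any-Vec? : ∀ {A} → Searchable A → ∀ n → Searchable (Vec A n)
any-Vec? any-A? zero    P? = map′ ([] ,_) (λ { ([] , P[]) → P[] }) (P? [])
any-Vec? any-A? (suc n) P? =
  map′ (λ (x , xs , Px∷xs) → x ∷ xs , Px∷xs) (λ { (x ∷ xs , Px∷xs) → x , xs , Px∷xs })
       (any-A? (λ x → any-Vec? any-A? n (λ xs → P? (x ∷ xs))))

isTotalOrder? : ∀ {N} {E : Rel (Fin N) 0ℓ} → Decidable E → Dec (IsTotalOrder _≡_ E)
isTotalOrder? {E = E} E? = map′ fromLaws toLaws
  (all? (λ x → E? x x) ×-dec
   all? (λ x → all? λ y → E? x y →-dec E? y x →-dec x ≟ y) ×-dec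
   all? (λ x → all? λ y → all? λ z → E? x y →-dec E? y z →-dec E? x z) ×-dec
   all? (λ x → all? λ y → E? x y ⊎-dec E? y x))
  where
  Laws : Set
  Laws = (∀ x → E x x) × (∀ x y → E x y → E y x → x ≡ y) ×
         (∀ x y z → E x y → E y z → E x z) × (∀ x y → E x y ⊎ E y x)

  fromLaws : Laws → IsTotalOrder _≡_ E
  fromLaws (refl′ , antisym , trans′ , total) = record
    { isPartialOrder = record
      { isPreorder = record
        { isEquivalence = isEquivalence
        ; reflexive = λ { refl → refl′ _ }
        ; trans = trans′ _ _ _ }
      ; antisym = antisym _ _ }
    ; total = total }

  toLaws : IsTotalOrder _≡_ E → Laws
  toLaws tot = (λ _ → refl′) , (λ _ _ → antisym) , (λ _ _ _ → trans′) , total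
    where open IsTotalOrder tot renaming (refl to refl′; trans to trans′)

IsRealizer : ∀ {A : Set} {d} → Rel A 0ℓ → (Fin d → Rel A 0ℓ) → Set
IsRealizer R E = (∀ i → IsTotalOrder _≡_ (E i)) × (∀ i x y → R x y → E i x y) ×
                 (∀ x y → (∀ i → E i x y) → R x y)

isRealizer⇒realizer : ∀ {A : Set} {d} {R : Rel A 0ℓ} {E : Fin d → Rel A 0ℓ} →
                      IsRealizer R E → Realizer R d
isRealizer⇒realizer {E = E} (linear , extends , intersect) =
  record { ext = E ; linear = linear ; extends = extends ; intersect = intersect }

isRealizer? : ∀ {N d} {R : Rel (Fin N) 0ℓ} {E : Fin d → Rel (Fin N) 0ℓ} →
              Decidable R → (∀ i → Decidable (E i)) → Dec (IsRealizer R E)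
isRealizer? R? E? =
  all? (λ i → isTotalOrder? (E? i)) ×-dec
  all? (λ i → all? λ x → all? λ y → R? x y →-dec E? i x y) ×-dec
  all? (λ x → all? λ y → all? (λ i → E? i x y) →-dec R? x y)

module _ {N : ℕ} where

  Table : Set
  Table = Vec (Subset N) N

  ⟦_⟧ : Table → Rel (Fin N) 0ℓ
  ⟦ t ⟧ x y = T (lookup (lookup t x) y)

  ⟦_⟧? : ∀ t → Decidable ⟦ t ⟧
  ⟦ t ⟧? x y = T? (lookup (lookup t x) y)

  tables : ∀ {d} {E : Fin d → Rel (Fin N) 0ℓ} → (∀ i → Decidable (E i)) → Vec Table d
  tables E? = tabulate λ i → tabulate λ x → tabulate λ y → isYes (E? i x y)

  module _ {d} {E : Fin d → Rel (Fin N) 0ℓ} (E? : ∀ i → Decidable (E i)) where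

    lookup-tables : ∀ {i x y} → lookup (lookup (lookup (tables E?) i) x) y ≡ isYes (E? i x y)
    lookup-tables {i} {x} {y} = begin
      lookup (lookup (lookup (tables E?) i) x) y
        ≡⟨ cong (λ t → lookup (lookup t x) y) (lookup∘tabulate _ i) ⟩
      lookup (lookup (tabulate λ x → tabulate λ y → isYes (E? i x y)) x) y
        ≡⟨ cong (λ row → lookup row y) (lookup∘tabulate _ x) ⟩
      lookup (tabulate λ y → isYes (E? i x y)) y
        ≡⟨ lookup∘tabulate _ y ⟩
      isYes (E? i x y)
        ∎
      where open ≡-Reasoning

    ⟦tables⟧⁺ : ∀ {i x y} → E i x y → ⟦ lookup (tables E?) i ⟧ x y
    ⟦tables⟧⁺ Exy = subst T (sym lookup-tables) (fromWitness Exy)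

    ⟦tables⟧⁻ : ∀ {i x y} → ⟦ lookup (tables E?) i ⟧ x y → E i x y
    ⟦tables⟧⁻ ⟦Exy⟧ = toWitness (subst T lookup-tables ⟦Exy⟧)

realizer?-Fin : ∀ {N} {R : Rel (Fin N) 0ℓ} → Decidable R → ∀ d → Dec (Realizer R d)
realizer?-Fin {N} {R} R? d = map′ (isRealizer⇒realizer ∘ proj₂) realizer⇒tables
  (any-Vec? (any-Vec? anySubset? N) d (λ c → isRealizer? R? (λ i → ⟦ lookup c i ⟧?)))
  where
  realizer⇒tables : Realizer R d → ∃ λ (c : Vec Table d) → IsRealizer R (λ i → ⟦ lookup c i ⟧)
  realizer⇒tables r = tables E? ,
    (λ i → isTotalOrder-pullback id id (⟦tables⟧⁻ E?) (⟦tables⟧⁺ E?) (linear i)) ,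
    (λ i x y Rxy → ⟦tables⟧⁺ E? (extends i x y Rxy)) ,
    (λ x y h → intersect x y (λ i → ⟦tables⟧⁻ E? (h i)))
    where
    open Realizer r
    E? : ∀ i → Decidable (ext i)
    E? i = isTotalOrder⇒decidable _≟_ (linear i)

realizer? : ∀ {A : Set} {N} → Fin N ↔ A → {R : Rel A 0ℓ} → Decidable R → ∀ d → Dec (Realizer R d)
realizer? enum {R} R? d =
  map′ (realizer-pullback from from-injective from-mono from-reflects) (realizer-pullback to to-injective id id)
       (realizer?-Fin (λ i j → R? (to i) (to j)) d)
  where
  open Inverse enum
  to-injective : ∀ {i j} → to i ≡ to j → i ≡ j
  to-injective = Injection.injective (Inverse⇒Injection enum)
  from-injective : ∀ {x y} → from x ≡ from y → x ≡ y
  from-injective = Injection.injective (Inverse⇒Injection (↔-sym enum))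
  from-mono : ∀ {x y} → R x y → R (to (from x)) (to (from y))
  from-mono = subst₂ R (sym (strictlyInverseˡ _)) (sym (strictlyInverseˡ _))
  from-reflects : ∀ {x y} → R (to (from x)) (to (from y)) → R x y
  from-reflects = subst₂ R (strictlyInverseˡ _) (strictlyInverseˡ _)

isDim-between : ∀ {A : Set} {R : Rel A 0ℓ} {m} → 1 ≤ m → Dec (Realizer R m) → Realizer R (suc m) →
                (∀ d → 1 ≤ d → Realizer R d → m ≤ d) → ∃[ d ] (IsDim R d × m ≤ d × d ≤ m + 1)
isDim-between {m = m} 1≤m (yes r) _ lower = m , (1≤m , r , lower) , ≤-refl , m≤m+n m 1
isDim-between {m = m} _ (no ¬r) r lower = suc m , (s≤s z≤n , r , minimal) , n≤1+n m , ≤-reflexive (+-comm 1 m)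
  where
  minimal : ∀ d → 1 ≤ d → Realizer _ d → suc m ≤ d
  minimal d 1≤d r′ = ≤∧≢⇒< (lower d 1≤d r′) (λ { refl → ¬r r′ })

≤L? : ∀ {k} (L : FinLattice k) → Decidable (FinLattice._≤L_ L)
≤L? L = JoinSemilattice.≈-dec⇒≤-dec (Lattice.joinSemilattice lattice) _≟_
  where
  lattice : Lattice 0ℓ 0ℓ 0ℓ
  lattice = record { isLattice = FinLattice.isLattice L }

module _ {k₁ k₂} (L₁ : FinLattice k₁) (L₂ : FinLattice k₂) {a b : Fin k₁} where
  private
    open FinLattice L₁ using () renaming (_≤L_ to _≤₁_)
    open FinLattice L₂ using () renaming (_≤L_ to _≤₂_)
    _≼_ : Rel (Fin k₁ ⊎ Fin k₂) 0ℓ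
    _≼_ = adjunct L₁ L₂ a b

  adjunct? : Decidable _≼_
  adjunct? (inj₁ x) (inj₁ y) = ≤L? L₁ x y
  adjunct? (inj₂ x) (inj₂ y) = ≤L? L₂ x y
  adjunct? (inj₁ x) (inj₂ y) = ≤L? L₁ x a
  adjunct? (inj₂ x) (inj₁ y) = ≤L? L₁ b y

  adjunct-restrict₁ : ∀ {d} → Realizer _≼_ d → Realizer _≤₁_ d
  adjunct-restrict₁ = realizer-pullback inj₁ inj₁-injective id id

  adjunct-restrict₂ : ∀ {d} → Realizer _≼_ d → Realizer _≤₂_ d
  adjunct-restrict₂ = realizer-pullback inj₂ inj₂-injective id id

  module _ (a<b : a <[ _≤₁_ ] b) {p : ℕ}
           (r₁ : Realizer _≤₁_ (suc p)) (r₂ : Realizer _≤₂_ (suc (suc p))) where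
    private
      open IsLattice (FinLattice.isLattice L₁) using () renaming (trans to ≤₁-trans; antisym to ≤₁-antisym)
      open Realizer r₁ renaming (ext to E; linear to E-linear; extends to E-extends; intersect to E-intersect)
      open Realizer r₂ renaming (ext to F; linear to F-linear; extends to F-extends; intersect to F-intersect)

      b≰a : ¬ b ≤₁ a
      b≰a b≤a = proj₂ a<b (≤₁-antisym (proj₁ a<b) b≤a)

      module Low = Insertion (E zero) (F zero) (λ x → ≤L? L₁ x a)
      module High (j : Fin (suc p)) = Insertion (E j) (F (suc j)) (<[]? _≟_ (E-linear j) b)

      ext : Fin (suc (suc p)) → Rel (Fin k₁ ⊎ Fin k₂) 0ℓ
      ext zero    = Low._⊑_
      ext (suc j) = High._⊑_ j

      linear : ∀ i → IsTotalOrder _≡_ (ext i)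
      linear zero    = Low.⊑-isTotalOrder (E-linear zero) (F-linear zero)
      linear (suc j) = High.⊑-isTotalOrder j (E-linear j) (F-linear (suc j))

      High-downClosed : ∀ j {x y} → E j y x → x <[ E j ] b → y <[ E j ] b
      High-downClosed j = <[]-downClosed _≟_ (E-linear j)

      inj₂-ext⁺ : ∀ i {x y} → F i x y → ext i (inj₂ x) (inj₂ y)
      inj₂-ext⁺ zero    = Low.inj₂⊑inj₂⁺
      inj₂-ext⁺ (suc j) = High.inj₂⊑inj₂⁺ j

      inj₂-ext⁻ : ∀ i {x y} → ext i (inj₂ x) (inj₂ y) → F i x y
      inj₂-ext⁻ zero    = Low.inj₂⊑inj₂⁻
      inj₂-ext⁻ (suc j) = High.inj₂⊑inj₂⁻ j

      extends : ∀ i u v → u ≼ v → ext i u v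
      extends zero    (inj₁ x) (inj₁ y) x≤y = Low.inj₁⊑inj₁⁺ (E-extends zero _ _) ≤₁-trans x≤y
      extends (suc j) (inj₁ x) (inj₁ y) x≤y =
        High.inj₁⊑inj₁⁺ j id (High-downClosed j) (E-extends j x y x≤y)
      extends i       (inj₂ x) (inj₂ y) x≤y = inj₂-ext⁺ i (F-extends i x y x≤y)
      extends zero    (inj₁ x) (inj₂ y) x≤a = Low.inj₁⊑inj₂⁺ x≤a
      extends (suc j) (inj₁ x) (inj₂ y) x≤a =
        High.inj₁⊑inj₂⁺ j (E-extends j x b (≤₁-trans x≤a (proj₁ a<b)) , λ { refl → b≰a x≤a })
      extends zero    (inj₂ x) (inj₁ y) b≤y = Low.inj₂⊑inj₁⁺ (λ y≤a → b≰a (≤₁-trans b≤y y≤a))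
      extends (suc j) (inj₂ x) (inj₁ y) b≤y =
        High.inj₂⊑inj₁⁺ j λ (y≤b , y≢b) →
          y≢b (IsTotalOrder.antisym (E-linear j) y≤b (E-extends j b y b≤y))

      intersect : ∀ u v → (∀ i → ext i u v) → u ≼ v
      intersect (inj₁ x) (inj₁ y) h =
        E-intersect x y (λ j → High.inj₁⊑inj₁⁻ j (E-linear j) (High-downClosed j) (h (suc j)))
      intersect (inj₂ x) (inj₂ y) h = F-intersect x y (λ i → inj₂-ext⁻ i (h i))
      intersect (inj₁ x) (inj₂ y) h = Low.inj₁⊑inj₂⁻ (h zero)
      intersect (inj₂ x) (inj₁ y) h =
        E-intersect b y (λ j → ≮[]⇒≥ _≟_ (E-linear j) (High.inj₂⊑inj₁⁻ j (h (suc j))))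

    adjunct-realizer : Realizer _≼_ (suc (suc p))
    adjunct-realizer = record { ext = ext ; linear = linear ; extends = extends ; intersect = intersect }

mainTheorem7 : ∀ {k₁ k₂} (L₁ : FinLattice k₁) (L₂ : FinLattice k₂) (m n : ℕ) (a b : Fin k₁) →
    IsDim (FinLattice._≤L_ L₁) m → IsDim (FinLattice._≤L_ L₂) n →
    a <[ FinLattice._≤L_ L₁ ] b → ¬ Covers (FinLattice._≤L_ L₁) a b →
    (n ≤ m → ∃[ d ] (IsDim (adjunct L₁ L₂ a b) d × m ≤ d × d ≤ m + 1))
    × (m < n → IsDim (adjunct L₁ L₂ a b) n)
mainTheorem7 L₁ L₂ zero    _       a b (() , _) _ _ _
mainTheorem7 L₁ L₂ (suc m) zero    a b _ (() , _) _ _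
mainTheorem7 L₁ L₂ (suc m) (suc n) a b (1≤m , r₁ , min₁) (1≤n , r₂ , min₂) a<b _ =
  (λ n≤m → isDim-between 1≤m (realizer? +↔⊎ (adjunct? L₁ L₂) (suc m))
             (adjunct-realizer L₁ L₂ a<b r₁ (realizer-weaken (m≤n⇒m≤1+n (≤-pred n≤m)) r₂)) lower₁) ,
  (λ m<n → 1≤n , upper m<n r₂ , lower₂)
  where
  lower₁ : ∀ d → 1 ≤ d → Realizer (adjunct L₁ L₂ a b) d → suc m ≤ d
  lower₁ d 1≤d r = min₁ d 1≤d (adjunct-restrict₁ L₁ L₂ r)
  lower₂ : ∀ d → 1 ≤ d → Realizer (adjunct L₁ L₂ a b) d → suc n ≤ d
  lower₂ d 1≤d r = min₂ d 1≤d (adjunct-restrict₂ L₁ L₂ r)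
  upper : ∀ {n} → suc m < suc n →
          Realizer (FinLattice._≤L_ L₂) (suc n) → Realizer (adjunct L₁ L₂ a b) (suc n)
  upper {suc n} (s≤s (s≤s m≤n)) = adjunct-realizer L₁ L₂ a<b (realizer-weaken m≤n r₁)
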